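{- Let $k,\ell,b,n_1,n_2$ be positive integers with $k,\ell\leq b$, $2(k+b)<n_1$, $2(\ell+b)<n_2$. Let $\mathcal{R}$ be a proj-intersecting family of $k\times\ell$ rectangles in $\mathbb{Z}_{n_1}\times\mathbb{Z}_{n_2}$, and suppose that $\mathcal{R}$ contains $\ell$ $b$-blocking pairs (of the form $I_1\times J_0, I_2\times J_0$ with $d(I_1,I_2)\geq b+1$) with pairwise distinct bases. Then $|\mathcal{R}|\leq \ell n_1$.
   Context: For $u,v\in\mathbb{Z}_n$ the distance $d(u,v)$ is the smaller of $(u-v)\bmod n$ and $(v-u)\bmod n$. An interval of length $a$ in $\mathbb{Z}_n$ is a set $\{i+1,\ldots,i+a\}$ (mod $n$); the distance of two intervals is the minimum distance between an element of one and an element of the other. A $k\times\ell$ rectangle is $I\times J$ with $I$ an interval of length $k$ in $\mathbb{Z}_{n_1}$ and $J$ an interval of length $\ell$ in $\mathbb{Z}_{n_2}$. Rectangles $I\times J$, $I'\times J'$ are proj-intersecting if $I\cap I'\neq\emptyset$ or $J\cap J'\neq\emptyset$; a family is proj-intersecting if every two members are. Two rectangles $R_1=I_1\times J_0$, $R_2=I_2\times J_0$ with $d(I_1,I_2)\geq b+1$ form a $b$-blocking pair with base $J_0$. -}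

module Defs where

open import Data.Nat using (ℕ; suc; _+_; _*_; _∸_; _≤_; _⊓_; NonZero)
open import Data.Nat.DivMod using (_%_)
open import Data.Fin using (Fin; toℕ)
open import Data.Product using (_×_; _,_; ∃; ∃-syntax; proj₁; proj₂)
open import Data.Sum using (_⊎_)
open import Data.List using (List; length)
open import Data.List.Membership.Propositional using (_∈_)
open import Relation.Binary.PropositionalEquality using (_≡_; _≢_)

dist : (n : ℕ) → .{{NonZero n}} → Fin n → Fin n → ℕ
dist n u v = ((toℕ u + (n ∸ toℕ v)) % n) ⊓ ((toℕ v + (n ∸ toℕ u)) % n)

-- The interval of length a starting after i : {i+1, …, i+a} (mod n).
-- x belongs to it iff x ≡ i + t (mod n) for some 1 ≤ t ≤ a.
InInterval : (n : ℕ) → .{{NonZero n}} → (a : ℕ) → (i : Fin n) → Fin n → Set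
InInterval n a i x = ∃[ t ] (1 ≤ t × t ≤ a × toℕ x ≡ (toℕ i + t) % n)

IntervalsMeet : (n : ℕ) → .{{NonZero n}} → (a : ℕ) → Fin n → Fin n → Set
IntervalsMeet n a i i' = ∃[ x ] (InInterval n a i x × InInterval n a i' x)

IntervalDist≥ : (n : ℕ) → .{{NonZero n}} → (a : ℕ) → Fin n → Fin n → ℕ → Set
IntervalDist≥ n a i i' m =
  ∀ x y → InInterval n a i x → InInterval n a i' y → m ≤ dist n x y

-- A k×ℓ rectangle I×J in ℤ_{n₁}×ℤ_{n₂} is given by the pair of starting
-- points of I (length k) and J (length ℓ).
Rect : ℕ → ℕ → Set
Rect n₁ n₂ = Fin n₁ × Fin n₂

ProjIntersecting : (n₁ n₂ : ℕ) → .{{NonZero n₁}} → .{{NonZero n₂}} →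
                   (k ℓ : ℕ) → Rect n₁ n₂ → Rect n₁ n₂ → Set
ProjIntersecting n₁ n₂ k ℓ (i , j) (i' , j') =
  IntervalsMeet n₁ k i i' ⊎ IntervalsMeet n₂ ℓ j j'

ProjIntersectingFamily : (n₁ n₂ : ℕ) → .{{NonZero n₁}} → .{{NonZero n₂}} →
                         (k ℓ : ℕ) → List (Rect n₁ n₂) → Set
ProjIntersectingFamily n₁ n₂ k ℓ ℛ =
  ∀ {R R'} → R ∈ ℛ → R' ∈ ℛ → ProjIntersecting n₁ n₂ k ℓ R R'

-- A b-blocking pair: I₁ × J₀, I₂ × J₀ with d(I₁, I₂) ≥ b + 1.
-- Encoded as (start of I₁, start of I₂, start of the base J₀).
BlockingPairIn : (n₁ n₂ : ℕ) → .{{NonZero n₁}} → .{{NonZero n₂}} →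
                 (k b : ℕ) → List (Rect n₁ n₂) → Fin n₁ × Fin n₁ × Fin n₂ → Set
BlockingPairIn n₁ n₂ k b ℛ (i₁ , i₂ , j₀) =
  (i₁ , j₀) ∈ ℛ × (i₂ , j₀) ∈ ℛ × IntervalDist≥ n₁ k i₁ i₂ (suc b)

-- Let ℓ = m + 1 and call i the start of the interval {i+1, …, i+a}. A
-- rectangle I × J cannot meet both members I₁ × J₀, I₂ × J₀ of a b-blocking
-- pair through its first coordinate, since I₁ and I₂ are too far apart for an
-- interval of length k ≤ b; so J meets the base J₀ of every blocking pair.
-- After rotating ℤ_{n₂} so that one base starts at m, every such J starts in
-- [0, 2m] and no wrap-around occurs. If two such starts had s' > s + m, the ℓ
-- distinct bases, each meeting both intervals, would start in the window
-- [s' - m, s + m] of fewer than ℓ values. So all starts lie within m of each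
-- other and are determined by their residue mod ℓ, and R = I × J is determined
-- by (start of I, start of J mod ℓ), which takes at most n₁ ℓ values.
module Submission where

open import Defs
open import Data.Nat using (ℕ; zero; suc; pred; _+_; _*_; _∸_; _≤_; _<_; NonZero; z≤n; s≤s; s≤s⁻¹)
open import Data.Nat.Properties
open import Data.Nat.DivMod
open import Data.Nat.Solver using (module +-*-Solver)
open import Data.Fin as Fin using (Fin; toℕ; fromℕ<; combine)
open import Data.Fin.Properties using (toℕ-injective; toℕ<n; fromℕ<-injective; injective⇒≤; combine-injective)
open import Data.Product using (_×_; _,_; proj₁; proj₂; ∃₂)
open import Data.Sum using (inj₁; inj₂)
open import Data.Empty using (⊥; ⊥-elim)
open import Relation.Nullary using (yes; no)
open import Data.List using (List; length; lookup)
open import Data.List.Membership.Propositional using (_∈_)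
open import Data.List.Membership.Propositional.Properties using (∈-lookup)
open import Data.List.Relation.Unary.Unique.Propositional using (Unique)
open import Data.List.Relation.Unary.AllPairs using (_∷_)
import Data.List.Relation.Unary.All as All
open import Relation.Binary.PropositionalEquality
open import Relation.Binary.Definitions using (tri<; tri≈; tri>)
open import Algebra.Properties.CommutativeSemigroup +-commutativeSemigroup using (xy∙z≈xz∙y; x∙yz≈y∙xz)

[m%n+k]%n≡[m+k]%n : ∀ m k n .{{_ : NonZero n}} → (m % n + k) % n ≡ (m + k) % n
[m%n+k]%n≡[m+k]%n m k n = begin
  (m % n + k) % n          ≡⟨ %-distribˡ-+ (m % n) k n ⟩
  (m % n % n + k % n) % n  ≡⟨ cong (λ v → (v + k % n) % n) (m%n%n≡m%n m n) ⟩
  (m % n + k % n) % n      ≡⟨ %-distribˡ-+ m k n ⟨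
  (m + k) % n              ∎
  where open ≡-Reasoning

[[m+d]%n+[n∸m]]%n≡d : ∀ m d n .{{_ : NonZero n}} → m ≤ n → d < n →
                      ((m + d) % n + (n ∸ m)) % n ≡ d
[[m+d]%n+[n∸m]]%n≡d m d n m≤n d<n = begin
  ((m + d) % n + (n ∸ m)) % n  ≡⟨ [m%n+k]%n≡[m+k]%n (m + d) (n ∸ m) n ⟩
  (m + d + (n ∸ m)) % n        ≡⟨ cong (λ v → (v + (n ∸ m)) % n) (+-comm m d) ⟩
  (d + m + (n ∸ m)) % n        ≡⟨ cong (_% n) (+-assoc d m (n ∸ m)) ⟩
  (d + (m + (n ∸ m))) % n      ≡⟨ cong (λ v → (d + v) % n) (m+[n∸m]≡n m≤n) ⟩
  (d + n) % n                  ≡⟨ [m+n]%n≡m%n d n ⟩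
  d % n                        ≡⟨ m<n⇒m%n≡m d<n ⟩
  d                            ∎
  where open ≡-Reasoning

-- A carry would give a + t ≥ c + n ≥ t + n.
%-noWrap : ∀ {a t c n} .{{_ : NonZero n}} → a < n → t ≤ c → (a + t) % n ≡ c → a + t ≡ c
%-noWrap {a} {t} {c} {n} a<n t≤c eq =
  noCarry ((a + t) / n) (trans (m≡m%n+[m/n]*n (a + t) n) (cong (_+ (a + t) / n * n) eq))
  where
  noCarry : ∀ q → a + t ≡ c + q * n → a + t ≡ c
  noCarry zero    e = trans e (+-identityʳ c)
  noCarry (suc q) e = ⊥-elim (<⇒≱ a<n (+-cancelˡ-≤ t n a (begin
    t + n          ≤⟨ +-mono-≤ t≤c (m≤m+n n (q * n)) ⟩
    c + suc q * n  ≡⟨ e ⟨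
    a + t          ≡⟨ +-comm a t ⟩
    t + a          ∎)))
    where open ≤-Reasoning

%-≡∧/-<⇒+n≤ : ∀ {a c n} .{{_ : NonZero n}} → a % n ≡ c % n → a / n < c / n → a + n ≤ c
%-≡∧/-<⇒+n≤ {a} {c} {n} eq q< = begin
  a + n                          ≡⟨ cong (_+ n) (m≡m%n+[m/n]*n a n) ⟩
  a % n + a / n * n + n          ≡⟨ +-assoc (a % n) (a / n * n) n ⟩
  a % n + (a / n * n + n)        ≡⟨ cong (a % n +_) (+-comm (a / n * n) n) ⟩
  a % n + suc (a / n) * n        ≤⟨ +-mono-≤ (≤-reflexive eq) (*-monoˡ-≤ n q<) ⟩
  c % n + c / n * n              ≡⟨ m≡m%n+[m/n]*n c n ⟨
  c                              ∎
  where open ≤-Reasoning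

%-≡∧close⇒≡ : ∀ {a c} m → a % suc m ≡ c % suc m → a ≤ c + m → c ≤ a + m → a ≡ c
%-≡∧close⇒≡ {a} {c} m eq a≤ c≤ with <-cmp (a / suc m) (c / suc m)
... | tri< q< _ _ = ⊥-elim (1+n≰n (+-cancelˡ-≤ a (suc m) m (≤-trans (%-≡∧/-<⇒+n≤ eq q<) c≤)))
... | tri≈ _ q≡ _ = begin
  a                              ≡⟨ m≡m%n+[m/n]*n a (suc m) ⟩
  a % suc m + a / suc m * suc m  ≡⟨ cong₂ (λ r q → r + q * suc m) eq q≡ ⟩
  c % suc m + c / suc m * suc m  ≡⟨ m≡m%n+[m/n]*n c (suc m) ⟨
  c                              ∎
  where open ≡-Reasoning
... | tri> _ _ q> = ⊥-elim (1+n≰n (+-cancelˡ-≤ c (suc m) m (≤-trans (%-≡∧/-<⇒+n≤ (sym eq) q>) a≤)))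

dist-sym : ∀ n .{{_ : NonZero n}} (x y : Fin n) → dist n x y ≡ dist n y x
dist-sym n x y = ⊓-comm _ _

dist≤offset : ∀ n .{{_ : NonZero n}} (x y : Fin n) {d} → d < n → toℕ y ≡ (toℕ x + d) % n → dist n x y ≤ d
dist≤offset n x y {d} d<n y≡ = subst (dist n x y ≤_) offset≡d (m⊓n≤n _ _)
  where
  offset≡d : (toℕ y + (n ∸ toℕ x)) % n ≡ d
  offset≡d = trans (cong (λ v → (v + (n ∸ toℕ x)) % n) y≡)
                   ([[m+d]%n+[n∸m]]%n≡d (toℕ x) d n (<⇒≤ (toℕ<n x)) d<n)

module _ {n : ℕ} .{{_ : NonZero n}} {a : ℕ} {i : Fin n} where

  private
    dist-ordered≤ : ∀ {x y t s} → a < n → toℕ x ≡ (toℕ i + t) % n → toℕ y ≡ (toℕ i + s) % n →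
                    t ≤ s → s ≤ a → dist n x y ≤ a
    dist-ordered≤ {x} {y} {t} {s} a<n x≡ y≡ t≤s s≤a =
      ≤-trans (dist≤offset n x y (≤-<-trans s∸t≤a a<n) y≡x+[s∸t]) s∸t≤a
      where
      open ≡-Reasoning
      s∸t≤a : s ∸ t ≤ a
      s∸t≤a = ≤-trans (m∸n≤m s t) s≤a
      y≡x+[s∸t] : toℕ y ≡ (toℕ x + (s ∸ t)) % n
      y≡x+[s∸t] = begin
        toℕ y                        ≡⟨ y≡ ⟩
        (toℕ i + s) % n              ≡⟨ cong (λ v → (toℕ i + v) % n) (m+[n∸m]≡n t≤s) ⟨
        (toℕ i + (t + (s ∸ t))) % n  ≡⟨ cong (_% n) (+-assoc (toℕ i) t (s ∸ t)) ⟨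
        (toℕ i + t + (s ∸ t)) % n    ≡⟨ [m%n+k]%n≡[m+k]%n (toℕ i + t) (s ∸ t) n ⟨
        ((toℕ i + t) % n + (s ∸ t)) % n ≡⟨ cong (λ v → (v + (s ∸ t)) % n) x≡ ⟨
        (toℕ x + (s ∸ t)) % n        ∎

  dist-inInterval≤ : ∀ {x y} → a < n → InInterval n a i x → InInterval n a i y → dist n x y ≤ a
  dist-inInterval≤ {x} {y} a<n (t , _ , t≤a , x≡) (s , _ , s≤a , y≡) with ≤-total t s
  ... | inj₁ t≤s = dist-ordered≤ a<n x≡ y≡ t≤s s≤a
  ... | inj₂ s≤t = subst (_≤ a) (dist-sym n y x) (dist-ordered≤ a<n y≡ x≡ s≤t t≤a)

¬meet-both-far : ∀ {n k b} .{{_ : NonZero n}} {i i₁ i₂ : Fin n} → k ≤ b → b < n →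
                 IntervalDist≥ n k i₁ i₂ (suc b) → IntervalsMeet n k i i₁ → IntervalsMeet n k i i₂ → ⊥
¬meet-both-far k≤b b<n far (x , x∈I , x∈I₁) (y , y∈I , y∈I₂) =
  1+n≰n (≤-trans (far x y x∈I₁ y∈I₂) (≤-trans (dist-inInterval≤ (≤-<-trans k≤b b<n) x∈I y∈I) k≤b))

meetsBlockingBase : ∀ {n₁ n₂ k ℓ b} .{{_ : NonZero n₁}} .{{_ : NonZero n₂}} {ℛ : List (Rect n₁ n₂)} →
                    ProjIntersectingFamily n₁ n₂ k ℓ ℛ → k ≤ b → b < n₁ →
                    ∀ {i₁ i₂ j₀} → BlockingPairIn n₁ n₂ k b ℛ (i₁ , i₂ , j₀) →
                    ∀ {i j} → (i , j) ∈ ℛ → IntervalsMeet n₂ ℓ j j₀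
meetsBlockingBase pif k≤b b<n₁ (R₁∈ , R₂∈ , far) R∈ with pif R∈ R₁∈ | pif R∈ R₂∈
... | inj₂ meet | _         = meet
... | inj₁ _    | inj₂ meet = meet
... | inj₁ m₁   | inj₁ m₂   = ⊥-elim (¬meet-both-far k≤b b<n₁ far m₁ m₂)

meet-sym : ∀ {n ℓ} .{{_ : NonZero n}} {a c : Fin n} → IntervalsMeet n ℓ a c → IntervalsMeet n ℓ c a
meet-sym (x , x∈A , x∈C) = x , x∈C , x∈A

Unique-lookup-injective : ∀ {A : Set} {xs : List A} → Unique xs → ∀ i j → lookup xs i ≡ lookup xs j → i ≡ j
Unique-lookup-injective (_ ∷ _)          Fin.zero    Fin.zero    _  = refl
Unique-lookup-injective (x∉xs ∷ _)       Fin.zero    (Fin.suc j) eq = ⊥-elim (All.lookup x∉xs (∈-lookup j) eq)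
Unique-lookup-injective (x∉xs ∷ _)       (Fin.suc i) Fin.zero    eq = ⊥-elim (All.lookup x∉xs (∈-lookup i) (sym eq))
Unique-lookup-injective (_ ∷ unique-xs) (Fin.suc i) (Fin.suc j) eq = cong Fin.suc (Unique-lookup-injective unique-xs i j eq)

injectiveOn⇒length≤ : ∀ {A : Set} {xs : List A} {N} → Unique xs → (f : A → Fin N) →
                      (∀ {x y} → x ∈ xs → y ∈ xs → f x ≡ f y → x ≡ y) → length xs ≤ N
injectiveOn⇒length≤ {xs = xs} unique f f-inj = injective⇒≤ {f = λ i → f (lookup xs i)}
  (λ {i} {j} eq → Unique-lookup-injective unique i j (f-inj (∈-lookup i) (∈-lookup j) eq))

injective⇒≤-window : ∀ {a} hi w (f : Fin a → ℕ) → (∀ {r s} → f r ≡ f s → r ≡ s) →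
                     (∀ r → f r < hi) → (∀ r → hi ≤ f r + w) → a ≤ w
injective⇒≤-window {a} hi w f f-inj <hi hi≤ = injective⇒≤ {f = g} g-inj
  where
  g-bound : ∀ r → f r + w ∸ hi < w
  g-bound r = subst (f r + w ∸ hi <_) (m+n∸m≡n hi w) (∸-monoˡ-< (+-monoˡ-< w (<hi r)) (hi≤ r))
  g : Fin a → Fin w
  g r = fromℕ< (g-bound r)
  g-inj : ∀ {r s} → g r ≡ g s → r ≡ s
  g-inj {r} {s} eq = f-inj (+-cancelʳ-≡ w (f r) (f s)
    (∸-cancelʳ-≡ (hi≤ r) (hi≤ s) (fromℕ<-injective _ _ (g-bound r) (g-bound s) eq)))

module Rotation (n : ℕ) .{{_ : NonZero n}} (K : ℕ) where

  rot : Fin n → ℕ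
  rot x = (toℕ x + K) % n

  rot-+ : ∀ (x : Fin n) t → (rot x + t) % n ≡ ((toℕ x + t) % n + K) % n
  rot-+ x t = begin
    (rot x + t) % n            ≡⟨ [m%n+k]%n≡[m+k]%n (toℕ x + K) t n ⟩
    (toℕ x + K + t) % n        ≡⟨ cong (_% n) (xy∙z≈xz∙y (toℕ x) K t) ⟩
    (toℕ x + t + K) % n        ≡⟨ [m%n+k]%n≡[m+k]%n (toℕ x + t) K n ⟨
    ((toℕ x + t) % n + K) % n  ∎
    where open ≡-Reasoning

  rot-cong-+ : ∀ {a c : Fin n} {t t'} → (toℕ a + t) % n ≡ (toℕ c + t') % n →
               (rot a + t) % n ≡ (rot c + t') % n
  rot-cong-+ {a} {c} {t} {t'} eq =
    trans (rot-+ a t) (trans (cong (λ v → (v + K) % n) eq) (sym (rot-+ c t')))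

  unrot : ∀ (x : Fin n) → (rot x + K * pred n) % n ≡ toℕ x
  unrot x = begin
    (rot x + K * pred n) % n        ≡⟨ [m%n+k]%n≡[m+k]%n (toℕ x + K) (K * pred n) n ⟩
    (toℕ x + K + K * pred n) % n    ≡⟨ cong (_% n) (+-assoc (toℕ x) K (K * pred n)) ⟩
    (toℕ x + (K + K * pred n)) % n  ≡⟨ cong (λ v → (toℕ x + v) % n) (*-suc K (pred n)) ⟨
    (toℕ x + K * suc (pred n)) % n  ≡⟨ cong (λ v → (toℕ x + K * v) % n) (suc-pred n) ⟩
    (toℕ x + K * n) % n             ≡⟨ [m+kn]%n≡m%n (toℕ x) K n ⟩
    toℕ x % n                       ≡⟨ m<n⇒m%n≡m (toℕ<n x) ⟩
    toℕ x                           ∎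
    where open ≡-Reasoning

  rot-injective : ∀ {x y : Fin n} → rot x ≡ rot y → x ≡ y
  rot-injective {x} {y} eq =
    toℕ-injective (trans (sym (unrot x)) (trans (cong (λ v → (v + K * pred n) % n) eq) (unrot y)))

  rot<n : ∀ x → rot x < n
  rot<n x = m%n<n (toℕ x + K) n

  rot-meet : ∀ {ℓ} {a c : Fin n} → IntervalsMeet n ℓ a c →
             ∃₂ λ t t' → 1 ≤ t × t ≤ ℓ × 1 ≤ t' × t' ≤ ℓ × (rot a + t) % n ≡ (rot c + t') % n
  rot-meet (_ , (t , 1≤t , t≤ℓ , x≡) , (t' , 1≤t' , t'≤ℓ , x≡')) =
    t , t' , 1≤t , t≤ℓ , 1≤t' , t'≤ℓ , rot-cong-+ (trans (sym x≡) x≡')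

+-offsets⇒≤ : ∀ {x t y t'} m → x + t ≡ y + t' → 1 ≤ t → t' ≤ suc m → x ≤ y + m
+-offsets⇒≤ {x} {t} {y} {t'} m eq 1≤t t'≤1+m = s≤s⁻¹ (begin
  suc x      ≡⟨ +-comm 1 x ⟩
  x + 1      ≤⟨ +-monoʳ-≤ x 1≤t ⟩
  x + t      ≡⟨ eq ⟩
  y + t'     ≤⟨ +-monoʳ-≤ y t'≤1+m ⟩
  y + suc m  ≡⟨ +-suc y m ⟩
  suc (y + m) ∎)
  where open ≤-Reasoning

module Columns (n : ℕ) .{{_ : NonZero n}} (m : ℕ) (room : m + m + suc m < n)
               (base : Fin (suc m) → Fin n)
               (bases-distinct : ∀ r s → r ≢ s → base r ≢ base s)
               (bases-meet-base₀ : ∀ r → IntervalsMeet n (suc m) (base r) (base Fin.zero)) where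

  open Rotation n (m + (n ∸ toℕ (base Fin.zero))) public

  MeetsAllBases : Fin n → Set
  MeetsAllBases j = ∀ r → IntervalsMeet n (suc m) j (base r)

  private
    m<n : m < n
    m<n = ≤-<-trans (≤-trans (m≤m+n m m) (m≤m+n (m + m) (suc m))) room

    small+offset<n : ∀ {x s} → x ≤ m + m → s ≤ suc m → x + s < n
    small+offset<n x≤ s≤ = ≤-<-trans (+-mono-≤ x≤ s≤) room

  rot-base₀ : rot (base Fin.zero) ≡ m
  rot-base₀ = begin
    (b₀ + (m + (n ∸ b₀))) % n  ≡⟨ cong (_% n) (x∙yz≈y∙xz b₀ m (n ∸ b₀)) ⟩
    (m + (b₀ + (n ∸ b₀))) % n  ≡⟨ cong (λ v → (m + v) % n) (m+[n∸m]≡n (<⇒≤ (toℕ<n (base Fin.zero)))) ⟩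
    (m + n) % n                ≡⟨ [m+n]%n≡m%n m n ⟩
    m % n                      ≡⟨ m<n⇒m%n≡m m<n ⟩
    m                          ∎
    where
    open ≡-Reasoning
    b₀ : ℕ
    b₀ = toℕ (base Fin.zero)

  rot≤2m : ∀ {j} → IntervalsMeet n (suc m) j (base Fin.zero) → rot j ≤ m + m
  rot≤2m {j} meet with rot-meet meet
  ... | t , t' , 1≤t , t≤1+m , 1≤t' , t'≤1+m , eq =
    +-offsets⇒≤ m (%-noWrap (rot<n j) t≤m+t' eq') 1≤t t'≤1+m
    where
    t≤m+t' : t ≤ m + t'
    t≤m+t' = ≤-trans t≤1+m (≤-trans (≤-reflexive (+-comm 1 m)) (+-monoʳ-≤ m 1≤t'))
    eq' : (rot j + t) % n ≡ m + t'
    eq' = trans eq (trans (cong (λ v → (v + t') % n) rot-base₀) (m<n⇒m%n≡m (small+offset<n (m≤m+n m m) t'≤1+m)))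

  rot-close : ∀ {a c} → rot a ≤ m + m → rot c ≤ m + m → IntervalsMeet n (suc m) a c → rot a ≤ rot c + m
  rot-close a≤ c≤ meet with rot-meet meet
  ... | t , t' , 1≤t , t≤1+m , 1≤t' , t'≤1+m , eq =
    +-offsets⇒≤ m (trans (sym (m<n⇒m%n≡m (small+offset<n a≤ t≤1+m)))
                         (trans eq (m<n⇒m%n≡m (small+offset<n c≤ t'≤1+m))))
                1≤t t'≤1+m

  rot-base-injective : ∀ {r s} → rot (base r) ≡ rot (base s) → r ≡ s
  rot-base-injective {r} {s} eq with r Fin.≟ s
  ... | yes r≡s = r≡s
  ... | no r≢s  = ⊥-elim (bases-distinct r s r≢s (rot-injective eq))

  -- Otherwise the m + 1 distinct values rot (base r) would lie in [rot j - m, rot j).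
  meetsAll⇒close : ∀ {j j'} → MeetsAllBases j → MeetsAllBases j' → rot j ≤ rot j' + m
  meetsAll⇒close {j} {j'} all-j all-j' with rot j ≤? rot j' + m
  ... | yes close = close
  ... | no far    = ⊥-elim (1+n≰n
    (injective⇒≤-window (rot j) m (λ r → rot (base r)) rot-base-injective below above))
    where
    base≤2m : ∀ r → rot (base r) ≤ m + m
    base≤2m r = rot≤2m (bases-meet-base₀ r)
    below : ∀ r → rot (base r) < rot j
    below r = ≤-<-trans (rot-close (base≤2m r) (rot≤2m (all-j' Fin.zero)) (meet-sym (all-j' r))) (≰⇒> far)
    above : ∀ r → rot j ≤ rot (base r) + m
    above r = rot-close (rot≤2m (all-j Fin.zero)) (base≤2m r) (all-j r)

  meetsAll-≡ : ∀ {j j'} → MeetsAllBases j → MeetsAllBases j' → rot j % suc m ≡ rot j' % suc m → j ≡ j'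
  meetsAll-≡ all-j all-j' eq =
    rot-injective (%-≡∧close⇒≡ m eq (meetsAll⇒close all-j all-j') (meetsAll⇒close all-j' all-j))

3m+1<2[1+m+b] : ∀ m b → suc m ≤ b → m + m + suc m < 2 * (suc m + b)
3m+1<2[1+m+b] m b 1+m≤b = begin-strict
  m + m + suc m                    <⟨ m<m+n (m + m + suc m) (s≤s z≤n) ⟩
  m + m + suc m + (3 + m)          ≡⟨ solve 1 (λ m → m :+ m :+ (con 1 :+ m) :+ (con 3 :+ m)
                                                   := con 2 :* ((con 1 :+ m) :+ (con 1 :+ m))) refl m ⟩
  2 * (suc m + suc m)              ≤⟨ *-monoʳ-≤ 2 (+-monoʳ-≤ (suc m) 1+m≤b) ⟩
  2 * (suc m + b)                  ∎
  where
  open ≤-Reasoning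
  open +-*-Solver

corollary1 : (k ℓ b n₁ n₂ : ℕ) → .{{_ : NonZero n₁}} → .{{_ : NonZero n₂}} →
    1 ≤ k → 1 ≤ ℓ → 1 ≤ b →
    k ≤ b → ℓ ≤ b → 2 * (k + b) < n₁ → 2 * (ℓ + b) < n₂ →
    (ℛ : List (Rect n₁ n₂)) → Unique ℛ →
    ProjIntersectingFamily n₁ n₂ k ℓ ℛ →
    (p : Fin ℓ → Fin n₁ × Fin n₁ × Fin n₂) →
    (∀ r → BlockingPairIn n₁ n₂ k b ℛ (p r)) →
    (∀ r s → r ≢ s → proj₂ (proj₂ (p r)) ≢ proj₂ (proj₂ (p s))) →
    length ℛ ≤ ℓ * n₁
corollary1 k zero    b n₁ n₂ _ () _ _ _ _ _ _ _ _ _ _ _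
corollary1 k (suc m) b n₁ n₂ _ _ _ k≤b ℓ≤b k+b-small ℓ+b-small ℛ unique proj-int p blocking distinct =
  injectiveOn⇒length≤ unique code code-injective
  where
  b<n₁ : b < n₁
  b<n₁ = ≤-<-trans (≤-trans (m≤n+m b k) (m≤m+n (k + b) (k + b + 0))) k+b-small

  columnsMeetBases : ∀ {i j} → (i , j) ∈ ℛ → ∀ r → IntervalsMeet n₂ (suc m) j (proj₂ (proj₂ (p r)))
  columnsMeetBases R∈ r = meetsBlockingBase proj-int k≤b b<n₁ (blocking r) R∈

  open Columns n₂ m (<-≤-trans (3m+1<2[1+m+b] m b ℓ≤b) (<⇒≤ ℓ+b-small)) (λ r → proj₂ (proj₂ (p r)))
               distinct (λ r → columnsMeetBases (proj₁ (blocking r)) Fin.zero)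

  code : Rect n₁ n₂ → Fin (suc m * n₁)
  code (i , j) = combine (fromℕ< (m%n<n (rot j) (suc m))) i

  code-injective : ∀ {R R'} → R ∈ ℛ → R' ∈ ℛ → code R ≡ code R' → R ≡ R'
  code-injective {i , j} {i' , j'} R∈ R'∈ eq with combine-injective _ i _ i' eq
  ... | residues≡ , i≡i' = cong₂ _,_ i≡i'
    (meetsAll-≡ (columnsMeetBases R∈) (columnsMeetBases R'∈) (fromℕ<-injective _ _ _ _ residues≡))
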